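{- Let T1 be the Hilbert system described in the context, and let T1$''$ be the system obtained from T1 by replacing the axiom scheme (B) with the two schemes (B'1) $\square(A\leftrightarrow B)\leftrightarrow([A]=[B])$, (B'2) $\forall v.\big([A(v)]_{\bar x}=[B(v)]_{\bar x}\big)\leftrightarrow [A(v)]_{\bar x v}=[B(v)]_{\bar x v}$, for formulas $A,B$, a variable $v$ and sequences $\bar x$ of distinct variables such that $\bar x v$ consists of distinct variables. Then T1 and T1$''$ are equivalent, i.e. they have the same theorems.
   Context: The language $L^\omega$ has countably many variables, countably many $n$-ary predicate symbols including a distinguished binary predicate $=$, connectives $\&,\sim$, the quantifier $\exists$ (with $\rightarrow,\leftrightarrow,\vee,\forall$ defined as usual), and an intensional abstraction operator. Terms and formulas are defined simultaneously: variables are terms; if $t_1,\dots,t_n$ are terms and $F$ is $n$-ary then $F(t_1,\dots,t_n)$ is a formula; if $A,B$ are formulas and $v$ a variable then $(A\&B)$, $\sim A$, $\exists v. A$ are formulas; if $A$ is a formula and $v_1,\dots,v_m$ ($m\ge 0$) are distinct variables then $[A]_{v_1\dots v_m}$ is a term (variables $v_i$ are bound in it); write $[A]$ when $m=0$. Define $\square A :\equiv [A] = [[A]=[A]]$ and $\lozenge A :\equiv \sim\square\sim A$; $\forall \bar x$ abbreviates a string of universal quantifiers over the variables of $\bar x$. The system T1 has the axioms: all tautologies; (Ins) $\forall v. A(v)\rightarrow A(t)$ for $t$ free for $v$ in $A$; (QImp) $\forall v.(A\rightarrow B)\rightarrow(A\rightarrow\forall v. B)$ for $v$ not free in $A$;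 (Id) $v=v$; (L) $v=w\rightarrow(A(v,v)\leftrightarrow A(v,w))$, where $A(v,w)$ results from $A(v,v)$ by replacing some free occurrences of $v$ by $w$, $w$ being free for $v$ at those positions; $\sim [A]_{\bar x}=[B]_{\bar y}$ whenever $\bar x,\bar y$ have different lengths; $[A]_{\bar x}=[A']_{\bar x'}$ whenever these are alphabetic variants ($\alpha$-equivalence); (B) $[A]_{\bar x}=[B]_{\bar x}\leftrightarrow\square\forall\bar x.(A\leftrightarrow B)$; (T) $\square A\rightarrow A$; (K) $\square(A\rightarrow B)\rightarrow(\square A\rightarrow\square B)$; (S5) $\lozenge A\rightarrow\square\lozenge A$. Rules: (MP) from $A$ and $A\rightarrow B$ infer $B$; (N) from $A$ infer $\square A$; (Gen) from $A$ infer $\forall v. A$. -}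

module Defs where

open import Data.Nat using (ℕ; zero; suc; _≡ᵇ_)
open import Data.Bool using (Bool; true; false; T; not; _∧_; _∨_; if_then_else_)
open import Data.List using (List; []; _∷_; _++_; length; foldr)
open import Data.Bool.ListAction using (any; all)
open import Data.Vec using (Vec; []; _∷_)
open import Data.Maybe using (Maybe; just; nothing; map)
open import Data.Unit using (tt)
open import Data.Sum using (_⊎_)
open import Relation.Binary.PropositionalEquality using (_≡_; _≢_)

Var : Set
Var = ℕ

elem : Var → List Var → Bool
elem v xs = any (v ≡ᵇ_) xs

distinct : List Var → Bool
distinct []       = true
distinct (x ∷ xs) = not (elem x xs) ∧ distinct xs

-- Syntax of L^ω.  Predicate symbols: for each arity n, countably many
-- (indexed by k : ℕ), plus the distinguished binary predicate  _≐_ .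
-- abs xs p A  is the intensional abstract  [A]_{xs}.

infix  8 _≐_
infixr 6 _&_
infix  7 ~_

mutual
  data Term : Set where
    var : Var → Term
    abs : (xs : List Var) → T (distinct xs) → Formula → Term

  data Formula : Set where
    pred : (n k : ℕ) → Vec Term n → Formula
    _≐_  : Term → Term → Formula
    _&_  : Formula → Formula → Formula
    ~_   : Formula → Formula
    ex   : Var → Formula → Formula

infixr 4 _⇒_
infix  3 _⇔_

_⇒_ : Formula → Formula → Formula
A ⇒ B = ~ (A & ~ B)

_⇔_ : Formula → Formula → Formula
A ⇔ B = (A ⇒ B) & (B ⇒ A)

fa : Var → Formula → Formula
fa v A = ~ ex v (~ A)

faMany : List Var → Formula → Formula
faMany xs A = foldr fa A xs

⟦_⟧ : Formula → Term
⟦ A ⟧ = abs [] tt A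

box : Formula → Formula
box A = ⟦ A ⟧ ≐ ⟦ ⟦ A ⟧ ≐ ⟦ A ⟧ ⟧

dia : Formula → Formula
dia A = ~ box (~ A)

mutual
  freeT : Var → Term → Bool
  freeT v (var x)      = v ≡ᵇ x
  freeT v (abs xs _ A) = not (elem v xs) ∧ freeF v A

  freeF : Var → Formula → Bool
  freeF v (pred n k ts) = freeV v ts
  freeF v (t ≐ u)       = freeT v t ∨ freeT v u
  freeF v (A & B)       = freeF v A ∨ freeF v B
  freeF v (~ A)         = freeF v A
  freeF v (ex x A)      = not (v ≡ᵇ x) ∧ freeF v A

  freeV : ∀ {n} → Var → Vec Term n → Bool
  freeV v []       = false
  freeV v (t ∷ ts) = freeT v t ∨ freeV v ts

-- Substitution of t for the free occurrences of v (capture is not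
-- avoided; it is only used under the side condition "t free for v").

mutual
  subT : Term → Var → Term → Term
  subT t v (var x)      = if v ≡ᵇ x then t else var x
  subT t v (abs xs p A) = if elem v xs then abs xs p A else abs xs p (subF t v A)

  subF : Term → Var → Formula → Formula
  subF t v (pred n k ts) = pred n k (subV t v ts)
  subF t v (a ≐ b)       = subT t v a ≐ subT t v b
  subF t v (A & B)       = subF t v A & subF t v B
  subF t v (~ A)         = ~ subF t v A
  subF t v (ex x A)      = if v ≡ᵇ x then ex x A else ex x (subF t v A)

  subV : ∀ {n} → Term → Var → Vec Term n → Vec Term n
  subV t v []       = []
  subV t v (u ∷ us) = subT t v u ∷ subV t v us

-- "t is free for v": no free occurrence of v lies in the scope of a
-- binder binding a variable free in t.
mutual
  ffT : Term → Var → Term → Bool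
  ffT t v (var x)      = true
  ffT t v (abs xs p A) =
    not (freeT v (abs xs p A)) ∨ (all (λ x → not (freeT x t)) xs ∧ ffF t v A)

  ffF : Term → Var → Formula → Bool
  ffF t v (pred n k ts) = ffV t v ts
  ffF t v (a ≐ b)       = ffT t v a ∧ ffT t v b
  ffF t v (A & B)       = ffF t v A ∧ ffF t v B
  ffF t v (~ A)         = ffF t v A
  ffF t v (ex x A)      = not (freeF v (ex x A)) ∨ (not (freeT x t) ∧ ffF t v A)

  ffV : ∀ {n} → Term → Var → Vec Term n → Bool
  ffV t v []       = true
  ffV t v (u ∷ us) = ffT t v u ∧ ffV t v us

-- Partial replacement for (L): PRF v w [] A A' means A' arises from A
-- by replacing some free occurrences of v by w, w being free for v at
-- those positions.  Γ is the list of variables bound at the position.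

mutual
  data PRT (v w : Var) : List Var → Term → Term → Set where
    keep : ∀ {Γ x} → PRT v w Γ (var x) (var x)
    repl : ∀ {Γ} → elem v Γ ≡ false → elem w Γ ≡ false → PRT v w Γ (var v) (var w)
    abs  : ∀ {Γ xs p A A'} → PRF v w (xs ++ Γ) A A' → PRT v w Γ (abs xs p A) (abs xs p A')

  data PRF (v w : Var) : List Var → Formula → Formula → Set where
    pred : ∀ {Γ n k ts ts'} → PRV v w Γ {n} ts ts' → PRF v w Γ (pred n k ts) (pred n k ts')
    eq   : ∀ {Γ a a' b b'} → PRT v w Γ a a' → PRT v w Γ b b' → PRF v w Γ (a ≐ b) (a' ≐ b')
    and  : ∀ {Γ A A' B B'} → PRF v w Γ A A' → PRF v w Γ B B' → PRF v w Γ (A & B) (A' & B')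
    neg  : ∀ {Γ A A'} → PRF v w Γ A A' → PRF v w Γ (~ A) (~ A')
    ex   : ∀ {Γ x A A'} → PRF v w (x ∷ Γ) A A' → PRF v w Γ (ex x A) (ex x A')

  data PRV (v w : Var) : List Var → {n : ℕ} → Vec Term n → Vec Term n → Set where
    []  : ∀ {Γ} → PRV v w Γ [] []
    _∷_ : ∀ {Γ n a a'} {as as' : Vec Term n} →
          PRT v w Γ a a' → PRV v w Γ as as' → PRV v w Γ (a ∷ as) (a' ∷ as')

-- Alphabetic variants (α-equivalence).  Γ, Δ: bound variables on each
-- side, innermost first; bound variables are matched by position.

idx : Var → List Var → Maybe ℕ
idx v []       = nothing
idx v (x ∷ xs) = if v ≡ᵇ x then just zero else map suc (idx v xs)

data AlphaVar (Γ Δ : List Var) (x y : Var) : Set where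
  bound : ∀ i → idx x Γ ≡ just i → idx y Δ ≡ just i → AlphaVar Γ Δ x y
  free  : idx x Γ ≡ nothing → idx y Δ ≡ nothing → x ≡ y → AlphaVar Γ Δ x y

mutual
  data AlphaT : List Var → List Var → Term → Term → Set where
    var : ∀ {Γ Δ x y} → AlphaVar Γ Δ x y → AlphaT Γ Δ (var x) (var y)
    abs : ∀ {Γ Δ xs ys p q A B} → length xs ≡ length ys →
          AlphaF (xs ++ Γ) (ys ++ Δ) A B → AlphaT Γ Δ (abs xs p A) (abs ys q B)

  data AlphaF : List Var → List Var → Formula → Formula → Set where
    pred : ∀ {Γ Δ n k ts ts'} → AlphaV Γ Δ {n} ts ts' → AlphaF Γ Δ (pred n k ts) (pred n k ts')
    eq   : ∀ {Γ Δ a a' b b'} → AlphaT Γ Δ a a' → AlphaT Γ Δ b b' → AlphaF Γ Δ (a ≐ b) (a' ≐ b')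
    and  : ∀ {Γ Δ A A' B B'} → AlphaF Γ Δ A A' → AlphaF Γ Δ B B' → AlphaF Γ Δ (A & B) (A' & B')
    neg  : ∀ {Γ Δ A A'} → AlphaF Γ Δ A A' → AlphaF Γ Δ (~ A) (~ A')
    ex   : ∀ {Γ Δ x y A B} → AlphaF (x ∷ Γ) (y ∷ Δ) A B → AlphaF Γ Δ (ex x A) (ex y B)

  data AlphaV : List Var → List Var → {n : ℕ} → Vec Term n → Vec Term n → Set where
    []  : ∀ {Γ Δ} → AlphaV Γ Δ [] []
    _∷_ : ∀ {Γ Δ n a a'} {as as' : Vec Term n} →
          AlphaT Γ Δ a a' → AlphaV Γ Δ as as' → AlphaV Γ Δ (a ∷ as) (a' ∷ as')

-- Tautologies: true under every valuation of the prime formulas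
-- (atomic and ∃-formulas), connectives & and ~ read truth-functionally.

eval : (Formula → Bool) → Formula → Bool
eval ρ (A & B) = eval ρ A ∧ eval ρ B
eval ρ (~ A)   = not (eval ρ A)
eval ρ A       = ρ A

Taut : Formula → Set
Taut A = (ρ : Formula → Bool) → eval ρ A ≡ true

data CommonAx : Formula → Set where
  taut  : ∀ {A} → Taut A → CommonAx A
  ins   : ∀ v A t → T (ffF t v A) → CommonAx (fa v A ⇒ subF t v A)
  qimp  : ∀ v A B → freeF v A ≡ false → CommonAx (fa v (A ⇒ B) ⇒ (A ⇒ fa v B))
  idAx  : ∀ v → CommonAx (var v ≐ var v)
  leib  : ∀ v w A A' → PRF v w [] A A' → CommonAx ((var v ≐ var w) ⇒ (A ⇔ A'))
  lenNe : ∀ xs p A ys q B → length xs ≢ length ys →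
          CommonAx (~ (abs xs p A ≐ abs ys q B))
  alpha : ∀ xs p A ys q B → AlphaT [] [] (abs xs p A) (abs ys q B) →
          CommonAx (abs xs p A ≐ abs ys q B)
  axT   : ∀ A → CommonAx (box A ⇒ A)
  axK   : ∀ A B → CommonAx (box (A ⇒ B) ⇒ (box A ⇒ box B))
  axS5  : ∀ A → CommonAx (dia A ⇒ box (dia A))

data AxB : Formula → Set where
  axB : ∀ xs p A B → AxB ((abs xs p A ≐ abs xs p B) ⇔ box (faMany xs (A ⇔ B)))

data AxB' : Formula → Set where
  axB'1 : ∀ A B → AxB' (box (A ⇔ B) ⇔ (⟦ A ⟧ ≐ ⟦ B ⟧))
  axB'2 : ∀ xs v A B (p : T (distinct xs)) (q : T (distinct (xs ++ v ∷ []))) →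
          AxB' (fa v (abs xs p A ≐ abs xs p B) ⇔
                (abs (xs ++ v ∷ []) q A ≐ abs (xs ++ v ∷ []) q B))

T1Ax : Formula → Set
T1Ax A = CommonAx A ⊎ AxB A

T1''Ax : Formula → Set
T1''Ax A = CommonAx A ⊎ AxB' A

data Prov (Ax : Formula → Set) : Formula → Set where
  ax  : ∀ {A} → Ax A → Prov Ax A
  mp  : ∀ {A B} → Prov Ax A → Prov Ax (A ⇒ B) → Prov Ax B
  nec : ∀ {A} → Prov Ax A → Prov Ax (box A)
  gen : ∀ {A} v → Prov Ax A → Prov Ax (fa v A)

-- Both systems share every axiom but the abstract-identity ones, so it suffices to derive
-- each system's extra axioms in the other.  The bridge is the S5 validity
-- ∀v □∀x̄ φ ⇔ □∀x̄∀v φ, obtained from the Barcan formula (provable from T, K, S5) and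
-- commutation of universal quantifiers.  Given it, (B'2) is (B) for x̄ followed by (B) for
-- x̄v, (B'1) is (B) with x̄ empty, and conversely (B) for x̄ = ȳv follows from (B'2) and
-- (B) for ȳ, by induction on x̄ from the right.
module Submission where

open import Defs
open import Data.Product using (_×_; _,_; proj₁; proj₂)
open import Data.Nat using (ℕ; zero; suc; _≡ᵇ_)
open import Data.Nat.Properties using (≡ᵇ⇒≡)
open import Data.Fin using (Fin; zero; suc)
open import Data.Bool using (Bool; true; false; T; not; _∧_)
open import Data.Bool.Properties using (∨-zeroʳ; T-≡; T-∧)
open import Data.List using (List; []; _∷_; _++_; _∷ʳ_)
open import Data.List.Properties using (foldr-++)
open import Data.List.Reverse using (Reverse; reverseView; []; _∶_∶ʳ_)
open import Data.Bool.ListAction using (all)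
open import Data.Vec using (Vec; []; _∷_; lookup; map)
open import Data.Vec.Properties using (lookup-map)
open import Data.Sum using (inj₁; inj₂)
open import Function using (Equivalence)
open import Relation.Binary.PropositionalEquality

open Equivalence using (to; from)

≡ᵇ-refl : ∀ n → (n ≡ᵇ n) ≡ true
≡ᵇ-refl zero    = refl
≡ᵇ-refl (suc n) = ≡ᵇ-refl n

≡ᵇ-sym : ∀ m n → (m ≡ᵇ n) ≡ (n ≡ᵇ m)
≡ᵇ-sym zero    zero    = refl
≡ᵇ-sym zero    (suc n) = refl
≡ᵇ-sym (suc m) zero    = refl
≡ᵇ-sym (suc m) (suc n) = ≡ᵇ-sym m n

elem-++ˡ : ∀ x xs ys → elem x xs ≡ true → elem x (xs ++ ys) ≡ true
elem-++ˡ x (y ∷ xs) ys e with x ≡ᵇ y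
... | true  = refl
... | false = elem-++ˡ x xs ys e

distinct-++ˡ : ∀ xs ys → T (distinct (xs ++ ys)) → T (distinct xs)
distinct-++ˡ []       ys p = _
distinct-++ˡ (x ∷ xs) ys p with elem x xs in x∈xs
... | true  = subst (λ b → T (not b)) (elem-++ˡ x xs ys x∈xs) (proj₁ (to T-∧ p))
... | false = distinct-++ˡ xs ys (proj₂ (to T-∧ p))

¬elem⇒fresh : ∀ v xs → elem v xs ≡ false → all (λ x → not (freeT x (var v))) xs ≡ true
¬elem⇒fresh v []       e = refl
¬elem⇒fresh v (x ∷ xs) e with v ≡ᵇ x in v≡x
... | false rewrite ≡ᵇ-sym x v | v≡x = ¬elem⇒fresh v xs e

mutual
  subT-self : ∀ v t → subT (var v) v t ≡ t
  subT-self v (var x) with v ≡ᵇ x in v≡x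
  ... | true  = cong var (≡ᵇ⇒≡ v x (from T-≡ v≡x))
  ... | false = refl
  subT-self v (abs xs p A) with elem v xs
  ... | true  = refl
  ... | false = cong (abs xs p) (subF-self v A)

  subF-self : ∀ v A → subF (var v) v A ≡ A
  subF-self v (pred n k ts) = cong (pred n k) (subV-self v ts)
  subF-self v (a ≐ b)       = cong₂ _≐_ (subT-self v a) (subT-self v b)
  subF-self v (A & B)       = cong₂ _&_ (subF-self v A) (subF-self v B)
  subF-self v (~ A)         = cong ~_ (subF-self v A)
  subF-self v (ex x A) with v ≡ᵇ x
  ... | true  = refl
  ... | false = cong (ex x) (subF-self v A)

  subV-self : ∀ {n} v (ts : Vec Term n) → subV (var v) v ts ≡ ts
  subV-self v []       = refl
  subV-self v (t ∷ ts) = cong₂ _∷_ (subT-self v t) (subV-self v ts)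

mutual
  ffT-self : ∀ v t → ffT (var v) v t ≡ true
  ffT-self v (var x) = refl
  ffT-self v (abs xs p A) with elem v xs in v∈xs
  ... | true  = refl
  ... | false rewrite ¬elem⇒fresh v xs v∈xs | ffF-self v A = ∨-zeroʳ _

  ffF-self : ∀ v A → ffF (var v) v A ≡ true
  ffF-self v (pred n k ts) = ffV-self v ts
  ffF-self v (a ≐ b) rewrite ffT-self v a | ffT-self v b = refl
  ffF-self v (A & B) rewrite ffF-self v A | ffF-self v B = refl
  ffF-self v (~ A)   = ffF-self v A
  ffF-self v (ex x A) with v ≡ᵇ x in v≡x
  ... | true  = refl
  ... | false rewrite ≡ᵇ-sym x v | v≡x | ffF-self v A = ∨-zeroʳ _

  ffV-self : ∀ {n} v (ts : Vec Term n) → ffV (var v) v ts ≡ true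
  ffV-self v []       = refl
  ffV-self v (t ∷ ts) rewrite ffT-self v t | ffV-self v ts = refl

fa-binds : ∀ v φ → freeF v (fa v φ) ≡ false
fa-binds v φ rewrite ≡ᵇ-refl v = refl

fa-fresh : ∀ y x φ → freeF y φ ≡ false → freeF y (fa x φ) ≡ false
fa-fresh y x φ y∉φ rewrite y∉φ with y ≡ᵇ x
... | true  = refl
... | false = refl

box-fresh : ∀ v A → freeF v A ≡ false → freeF v (box A) ≡ false
box-fresh v A v∉A rewrite v∉A = refl

infixr 6 _&ᵖ_
infix  7 ~ᵖ_
infixr 4 _⇒ᵖ_
infix  3 _⇔ᵖ_

data Schema (n : ℕ) : Set where
  atom  : Fin n → Schema n
  _&ᵖ_  : Schema n → Schema n → Schema n
  ~ᵖ_   : Schema n → Schema n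

_⇒ᵖ_ : ∀ {n} → Schema n → Schema n → Schema n
P ⇒ᵖ Q = ~ᵖ (P &ᵖ ~ᵖ Q)

_⇔ᵖ_ : ∀ {n} → Schema n → Schema n → Schema n
P ⇔ᵖ Q = (P ⇒ᵖ Q) &ᵖ (Q ⇒ᵖ P)

p₀ : ∀ {n} → Schema (suc n)
p₀ = atom zero

p₁ : ∀ {n} → Schema (suc (suc n))
p₁ = atom (suc zero)

p₂ : ∀ {n} → Schema (suc (suc (suc n)))
p₂ = atom (suc (suc zero))

instantiate : ∀ {n} → Schema n → Vec Formula n → Formula
instantiate (atom i) σ = lookup σ i
instantiate (P &ᵖ Q) σ = instantiate P σ & instantiate Q σ
instantiate (~ᵖ P)   σ = ~ instantiate P σ

truth : ∀ {n} → Vec Bool n → Schema n → Bool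
truth β (atom i) = lookup β i
truth β (P &ᵖ Q) = truth β P ∧ truth β Q
truth β (~ᵖ P)   = not (truth β P)

eval-instantiate : ∀ {n} ρ (P : Schema n) σ → eval ρ (instantiate P σ) ≡ truth (map (eval ρ) σ) P
eval-instantiate ρ (atom i) σ = sym (lookup-map i (eval ρ) σ)
eval-instantiate ρ (P &ᵖ Q) σ = cong₂ _∧_ (eval-instantiate ρ P σ) (eval-instantiate ρ Q σ)
eval-instantiate ρ (~ᵖ P)   σ = cong not (eval-instantiate ρ P σ)

allValuations : ∀ n → (Vec Bool n → Bool) → Bool
allValuations zero    f = f []
allValuations (suc n) f = allValuations n (λ β → f (true ∷ β)) ∧ allValuations n (λ β → f (false ∷ β))

allValuations-sound : ∀ n f → T (allValuations n f) → ∀ β → T (f β)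
allValuations-sound zero    f t []          = t
allValuations-sound (suc n) f t (true ∷ β)  = allValuations-sound n _ (proj₁ (to T-∧ t)) β
allValuations-sound (suc n) f t (false ∷ β) = allValuations-sound n _ (proj₂ (to T-∧ t)) β

valid : ∀ {n} → Schema n → Bool
valid {n} P = allValuations n (λ β → truth β P)

valid⇒Taut : ∀ {n} (P : Schema n) → T (valid P) → ∀ σ → Taut (instantiate P σ)
valid⇒Taut {n} P P-valid σ ρ =
  trans (eval-instantiate ρ P σ)
        (to T-≡ (allValuations-sound n (λ β → truth β P) P-valid (map (eval ρ) σ)))

module Derived (Ax : Formula → Set) (common : ∀ {A} → CommonAx A → Ax A) where

  ⊢_ : Formula → Set
  ⊢ A = Prov Ax A

  tautology : ∀ {n} (P : Schema n) (σ : Vec Formula n) {_ : T (valid P)} → ⊢ instantiate P σ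
  tautology P σ {P-valid} = ax (common (taut (valid⇒Taut P P-valid σ)))

  ⇒-trans : ∀ {A B C} → ⊢ (A ⇒ B) → ⊢ (B ⇒ C) → ⊢ (A ⇒ C)
  ⇒-trans {A} {B} {C} A⇒B B⇒C =
    mp B⇒C (mp A⇒B (tautology ((p₀ ⇒ᵖ p₁) ⇒ᵖ (p₁ ⇒ᵖ p₂) ⇒ᵖ (p₀ ⇒ᵖ p₂)) (A ∷ B ∷ C ∷ [])))

  ⇔-trans : ∀ {A B C} → ⊢ (A ⇔ B) → ⊢ (B ⇔ C) → ⊢ (A ⇔ C)
  ⇔-trans {A} {B} {C} A⇔B B⇔C =
    mp B⇔C (mp A⇔B (tautology ((p₀ ⇔ᵖ p₁) ⇒ᵖ (p₁ ⇔ᵖ p₂) ⇒ᵖ (p₀ ⇔ᵖ p₂)) (A ∷ B ∷ C ∷ [])))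

  ⇔-sym : ∀ {A B} → ⊢ (A ⇔ B) → ⊢ (B ⇔ A)
  ⇔-sym {A} {B} A⇔B = mp A⇔B (tautology ((p₀ ⇔ᵖ p₁) ⇒ᵖ (p₁ ⇔ᵖ p₀)) (A ∷ B ∷ []))

  ⇔-intro : ∀ {A B} → ⊢ (A ⇒ B) → ⊢ (B ⇒ A) → ⊢ (A ⇔ B)
  ⇔-intro {A} {B} A⇒B B⇒A =
    mp B⇒A (mp A⇒B (tautology ((p₀ ⇒ᵖ p₁) ⇒ᵖ (p₁ ⇒ᵖ p₀) ⇒ᵖ (p₀ ⇔ᵖ p₁)) (A ∷ B ∷ [])))

  ⇔-to : ∀ {A B} → ⊢ (A ⇔ B) → ⊢ (A ⇒ B)
  ⇔-to {A} {B} A⇔B = mp A⇔B (tautology ((p₀ ⇔ᵖ p₁) ⇒ᵖ (p₀ ⇒ᵖ p₁)) (A ∷ B ∷ []))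

  ⇔-from : ∀ {A B} → ⊢ (A ⇔ B) → ⊢ (B ⇒ A)
  ⇔-from {A} {B} A⇔B = mp A⇔B (tautology ((p₀ ⇔ᵖ p₁) ⇒ᵖ (p₁ ⇒ᵖ p₀)) (A ∷ B ∷ []))

  contraposition : ∀ {A B} → ⊢ (A ⇒ B) → ⊢ (~ B ⇒ ~ A)
  contraposition {A} {B} A⇒B = mp A⇒B (tautology ((p₀ ⇒ᵖ p₁) ⇒ᵖ (~ᵖ p₁ ⇒ᵖ ~ᵖ p₀)) (A ∷ B ∷ []))

  □-mono : ∀ {A B} → ⊢ (A ⇒ B) → ⊢ (box A ⇒ box B)
  □-mono {A} {B} A⇒B = mp (nec A⇒B) (ax (common (axK A B)))

  □-cong : ∀ {A B} → ⊢ (A ⇔ B) → ⊢ (box A ⇔ box B)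
  □-cong A⇔B = ⇔-intro (□-mono (⇔-to A⇔B)) (□-mono (⇔-from A⇔B))

  ◇-mono : ∀ {A B} → ⊢ (A ⇒ B) → ⊢ (dia A ⇒ dia B)
  ◇-mono A⇒B = contraposition (□-mono (contraposition A⇒B))

  ∀-elim : ∀ v φ → ⊢ (fa v φ ⇒ φ)
  ∀-elim v φ = subst (λ ψ → ⊢ (fa v φ ⇒ ψ)) (subF-self v φ)
                 (ax (common (ins v φ (var v) (from T-≡ (ffF-self v φ)))))

  ∀-intro : ∀ {A φ} v → freeF v A ≡ false → ⊢ (A ⇒ φ) → ⊢ (A ⇒ fa v φ)
  ∀-intro {A} {φ} v v∉A A⇒φ = mp (gen v A⇒φ) (ax (common (qimp v A φ v∉A)))

  ∀-mono : ∀ {φ ψ} v → ⊢ (φ ⇒ ψ) → ⊢ (fa v φ ⇒ fa v ψ)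
  ∀-mono {φ} v φ⇒ψ = ∀-intro v (fa-binds v φ) (⇒-trans (∀-elim v φ) φ⇒ψ)

  ∀-cong : ∀ {φ ψ} v → ⊢ (φ ⇔ ψ) → ⊢ (fa v φ ⇔ fa v ψ)
  ∀-cong v φ⇔ψ = ⇔-intro (∀-mono v (⇔-to φ⇔ψ)) (∀-mono v (⇔-from φ⇔ψ))

  ∀-comm : ∀ x y φ → ⊢ (fa x (fa y φ) ⇒ fa y (fa x φ))
  ∀-comm x y φ =
    ∀-intro y (fa-fresh y x (fa y φ) (fa-binds y φ))
      (∀-intro x (fa-binds x (fa y φ)) (⇒-trans (∀-elim x (fa y φ)) (∀-elim y φ)))

  ∀-faMany-comm : ∀ v ys φ → ⊢ (fa v (faMany ys φ) ⇔ faMany ys (fa v φ))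
  ∀-faMany-comm v []       φ = tautology (p₀ ⇔ᵖ p₀) (fa v φ ∷ [])
  ∀-faMany-comm v (y ∷ ys) φ =
    ⇔-trans (⇔-intro (∀-comm v y (faMany ys φ)) (∀-comm y v (faMany ys φ)))
            (∀-cong y (∀-faMany-comm v ys φ))

  ⇒□◇ : ∀ A → ⊢ (A ⇒ box (dia A))
  ⇒□◇ A = ⇒-trans (mp (ax (common (axT (~ A))))
                      (tautology ((p₁ ⇒ᵖ ~ᵖ p₀) ⇒ᵖ (p₀ ⇒ᵖ ~ᵖ p₁)) (A ∷ box (~ A) ∷ [])))
                   (ax (common (axS5 A)))

  ◇□⇒ : ∀ A → ⊢ (dia (box A) ⇒ A)
  ◇□⇒ A = mp ¬A⇒□¬□A (tautology ((~ᵖ p₀ ⇒ᵖ p₁) ⇒ᵖ (~ᵖ p₁ ⇒ᵖ p₀)) (A ∷ box (~ box A) ∷ []))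
    where
    □¬¬A⇔□A : ⊢ (box (~ ~ A) ⇔ box A)
    □¬¬A⇔□A = □-cong (tautology (~ᵖ ~ᵖ p₀ ⇔ᵖ p₀) (A ∷ []))

    ◇¬A⇒¬□A : ⊢ (dia (~ A) ⇒ ~ box A)
    ◇¬A⇒¬□A = mp □¬¬A⇔□A
      (tautology ((p₁ ⇔ᵖ p₀) ⇒ᵖ (~ᵖ p₁ ⇒ᵖ ~ᵖ p₀)) (box A ∷ box (~ ~ A) ∷ []))

    ¬A⇒□¬□A : ⊢ (~ A ⇒ box (~ box A))
    ¬A⇒□¬□A = ⇒-trans (⇒□◇ (~ A)) (□-mono ◇¬A⇒¬□A)

  -- Through ◇∀v□φ ⇒ φ: the quantifier can be introduced there since v is bound in ◇∀v□φ.
  barcan : ∀ v φ → ⊢ (fa v (box φ) ⇒ box (fa v φ))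
  barcan v φ = ⇒-trans (⇒□◇ ∀□φ) (□-mono ◇∀□φ⇒∀φ)
    where
    ∀□φ = fa v (box φ)

    ◇∀□φ⇒∀φ : ⊢ (dia ∀□φ ⇒ fa v φ)
    ◇∀□φ⇒∀φ = ∀-intro v (box-fresh v (~ ∀□φ) (fa-binds v (box φ)))
                (⇒-trans (◇-mono (∀-elim v (box φ))) (◇□⇒ φ))

  converse-barcan : ∀ v φ → ⊢ (box (fa v φ) ⇒ fa v (box φ))
  converse-barcan v φ = ∀-intro v (box-fresh v (fa v φ) (fa-binds v φ)) (□-mono (∀-elim v φ))

  ∀□faMany⇔□faMany-∷ʳ : ∀ v ys φ → ⊢ (fa v (box (faMany ys φ)) ⇔ box (faMany (ys ∷ʳ v) φ))
  ∀□faMany⇔□faMany-∷ʳ v ys φ rewrite foldr-++ fa φ ys (v ∷ []) =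
    ⇔-trans (⇔-intro (barcan v (faMany ys φ)) (converse-barcan v (faMany ys φ)))
            (□-cong (∀-faMany-comm v ys φ))

Prov-⊆ : ∀ {Ax Ax′} → (∀ {A} → Ax A → Prov Ax′ A) → ∀ {A} → Prov Ax A → Prov Ax′ A
Prov-⊆ derive (ax a)    = derive a
Prov-⊆ derive (mp d e)  = mp (Prov-⊆ derive d) (Prov-⊆ derive e)
Prov-⊆ derive (nec d)   = nec (Prov-⊆ derive d)
Prov-⊆ derive (gen v d) = gen v (Prov-⊆ derive d)

module T1 = Derived T1Ax inj₁
module T1'' = Derived T1''Ax inj₁

T1''⊢B : ∀ xs p A B → Prov T1''Ax ((abs xs p A ≐ abs xs p B) ⇔ box (faMany xs (A ⇔ B)))
T1''⊢B xs p A B = go xs (reverseView xs) p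
  where
  open T1''

  go : ∀ xs → Reverse xs → (p : T (distinct xs)) →
       ⊢ ((abs xs p A ≐ abs xs p B) ⇔ box (faMany xs (A ⇔ B)))
  go .[]        []             p = ⇔-sym (ax (inj₂ (axB'1 A B)))
  go .(ys ∷ʳ v) (ys ∶ ys′ ∶ʳ v) p =
    ⇔-trans (⇔-sym (ax (inj₂ (axB'2 ys v A B pys p))))
      (⇔-trans (∀-cong v (go ys ys′ pys)) (∀□faMany⇔□faMany-∷ʳ v ys (A ⇔ B)))
    where pys = distinct-++ˡ ys (v ∷ []) p

T1⊢B' : ∀ {F} → AxB' F → Prov T1Ax F
T1⊢B' (axB'1 A B) = T1.⇔-sym (ax (inj₂ (axB [] _ A B)))
T1⊢B' (axB'2 xs v A B p q) =
  ⇔-trans (∀-cong v (ax (inj₂ (axB xs p A B))))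
    (⇔-trans (∀□faMany⇔□faMany-∷ʳ v xs (A ⇔ B)) (⇔-sym (ax (inj₂ (axB (xs ∷ʳ v) q A B)))))
  where open T1

T1Ax⇒T1'' : ∀ {F} → T1Ax F → Prov T1''Ax F
T1Ax⇒T1'' (inj₁ a)                = ax (inj₁ a)
T1Ax⇒T1'' (inj₂ (axB xs p A B)) = T1''⊢B xs p A B

T1''Ax⇒T1 : ∀ {F} → T1''Ax F → Prov T1Ax F
T1''Ax⇒T1 (inj₁ a) = ax (inj₁ a)
T1''Ax⇒T1 (inj₂ b) = T1⊢B' b

lemma1p26 : ∀ A → (Prov T1Ax A → Prov T1''Ax A) × (Prov T1''Ax A → Prov T1Ax A)
lemma1p26 A = Prov-⊆ T1Ax⇒T1'' , Prov-⊆ T1''Ax⇒T1
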